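{- Let $G$ be a finite simple connected graph containing no induced $P_5$, $C_5$ or $K_{2,3}$, and suppose $G$ has no clique cut set. Let $S$ be a minimal cut set of $G$. Then: (a) $G-S$ has exactly two components, and for every pair of non-adjacent vertices $s_1,s_2\in S$, every induced $s_1s_2$-path whose internal vertices all lie in exactly one component of $G-S$ has length $2$; (b) each vertex of $S$ is complete to (adjacent to every vertex of) at least one component of $G-S$; (c) $\alpha(G[S])=2$.
   Context: A cut set is a set $S\subseteq V(G)$ with $G-S$ disconnected; it is minimal if no proper subset is a cut set; a clique cut set is a cut set that is a clique. $\alpha$ denotes the independence number. $P_t,C_t$ are the path and cycle on $t$ vertices, $K_{2,3}$ the complete bipartite graph with parts of sizes 2 and 3. -}

module Defs where

open import Data.Nat using (ℕ; zero; suc; _≤_; _<_; _∸_; _≡ᵇ_; _<ᵇ_)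
open import Data.Bool using (Bool; true; false; _∨_; _∧_; _xor_)
open import Data.Fin using (Fin; toℕ; zero; suc)
open import Data.Fin.Subset using (Subset; _∈_; _∉_; _⊆_; _⊂_; ∣_∣)
open import Data.Product using (Σ; _×_; ∃; ∃-syntax; _,_)
open import Data.Sum using (_⊎_)
open import Function.Definitions using (Injective)
open import Relation.Binary.PropositionalEquality using (_≡_; _≢_)
open import Relation.Nullary using (¬_)
open import Data.Unit using (⊤)

record Graph (n : ℕ) : Set where
  field
    adj    : Fin n → Fin n → Bool
    sym    : ∀ u v → adj u v ≡ adj v u
    irrefl : ∀ u → adj u u ≡ false
open Graph public

Adj : ∀ {n} → Graph n → Fin n → Fin n → Set
Adj G u v = adj G u v ≡ true

data Reach {n} (G : Graph n) (X : Fin n → Set) : Fin n → Fin n → Set where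
  here : ∀ {u} → X u → Reach G X u u
  step : ∀ {u v w} → X u → Adj G u v → Reach G X v w → Reach G X u w

ConnMinus : ∀ {n} → Graph n → Subset n → Fin n → Fin n → Set
ConnMinus G S = Reach G (λ x → x ∉ S)

Connected : ∀ {n} → Graph n → Set
Connected {n} G = ∀ (u v : Fin n) → Reach G (λ _ → ⊤) u v

CutSet : ∀ {n} → Graph n → Subset n → Set
CutSet G S = ∃[ u ] ∃[ v ] (u ∉ S × v ∉ S × ¬ ConnMinus G S u v)

MinimalCutSet : ∀ {n} → Graph n → Subset n → Set
MinimalCutSet G S = CutSet G S × (∀ T → T ⊂ S → ¬ CutSet G T)

IsClique : ∀ {n} → Graph n → Subset n → Set
IsClique G S = ∀ u v → u ∈ S → v ∈ S → u ≢ v → Adj G u v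

HasCliqueCutSet : ∀ {n} → Graph n → Set
HasCliqueCutSet G = ∃[ S ] (CutSet G S × IsClique G S)

pathAdj : (k : ℕ) → Fin k → Fin k → Bool
pathAdj k i j = (suc (toℕ i) ≡ᵇ toℕ j) ∨ (suc (toℕ j) ≡ᵇ toℕ i)

cycleAdj : (k : ℕ) → Fin k → Fin k → Bool
cycleAdj k i j = pathAdj k i j
  ∨ ((toℕ i ≡ᵇ 0) ∧ (toℕ j ≡ᵇ k ∸ 1))
  ∨ ((toℕ j ≡ᵇ 0) ∧ (toℕ i ≡ᵇ k ∸ 1))

-- K_{2,3} on Fin 5 with parts {0,1} and {2,3,4}.
k23Adj : Fin 5 → Fin 5 → Bool
k23Adj i j = (toℕ i <ᵇ 2) xor (toℕ j <ᵇ 2)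

InducedEmbedding : ∀ {n k} → (Fin k → Fin k → Bool) → Graph n → (Fin k → Fin n) → Set
InducedEmbedding {k = k} H G f = Injective _≡_ _≡_ f × (∀ (i j : Fin k) → adj G (f i) (f j) ≡ H i j)

ContainsInduced : ∀ {n} → (k : ℕ) → (Fin k → Fin k → Bool) → Graph n → Set
ContainsInduced {n} k H G = Σ (Fin k → Fin n) (InducedEmbedding H G)

P5C5K23Free : ∀ {n} → Graph n → Set
P5C5K23Free G = ¬ ContainsInduced 5 (pathAdj 5) G
              × ¬ ContainsInduced 5 (cycleAdj 5) G
              × ¬ ContainsInduced 5 k23Adj G

ExactlyTwoComponents : ∀ {n} → Graph n → Subset n → Set
ExactlyTwoComponents G S =
  ∃[ a ] ∃[ b ] (a ∉ S × b ∉ S × ¬ ConnMinus G S a b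
    × (∀ c → c ∉ S → ConnMinus G S a c ⊎ ConnMinus G S b c))

-- Induced path with m edges: p : Fin (suc m) → Fin n, injective, adjacency exactly consecutive.
first : ∀ {m} → Fin (suc m)
first = zero

lastF : ∀ m → Fin (suc m)
lastF zero = zero
lastF (suc m) = suc (lastF m)

IsInternal : ∀ {m} → Fin (suc m) → Set
IsInternal {m} i = 0 < toℕ i × toℕ i < m

InducedPathsLength2 : ∀ {n} → Graph n → Subset n → Set
InducedPathsLength2 {n} G S =
  ∀ s₁ s₂ → s₁ ∈ S → s₂ ∈ S → s₁ ≢ s₂ → ¬ Adj G s₁ s₂ →
  ∀ (m : ℕ) (p : Fin (suc m) → Fin n) →
  InducedEmbedding (pathAdj (suc m)) G p →
  p first ≡ s₁ → p (lastF m) ≡ s₂ →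
  (∀ i → IsInternal i → p i ∉ S) →
  (∀ i j → IsInternal i → IsInternal j → ConnMinus G S (p i) (p j)) →
  m ≡ 2

CompleteToSomeComponent : ∀ {n} → Graph n → Subset n → Set
CompleteToSomeComponent G S =
  ∀ s → s ∈ S → ∃[ a ] (a ∉ S × (∀ c → ConnMinus G S a c → Adj G s c))

IsIndependent : ∀ {n} → Graph n → Subset n → Set
IsIndependent G T = ∀ u v → u ∈ T → v ∈ T → ¬ Adj G u v

IndependenceNumberOfInduced : ∀ {n} → Graph n → Subset n → ℕ → Set
IndependenceNumberOfInduced G S k =
  (∃[ T ] (T ⊆ S × IsIndependent G T × ∣ T ∣ ≡ k))
  × (∀ T → T ⊆ S → IsIndependent G T → ∣ T ∣ ≤ k)

{-# OPTIONS --safe #-}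
-- By minimality every vertex of S has a neighbour in every component of G - S. A vertex s ∈ S that
-- misses a vertex of one component is complete to every other one, or boundary edges of N(s) in two
-- components would form an induced P5 through s. Since S is not a clique it has non-adjacent
-- vertices s₁, s₂, and these then have a common neighbour in every component (else an induced C5
-- or P5 appears), so a third component would create an induced K₂,₃. The other claims follow the
-- same way: a long induced path through one component, or an independent triple in S, would close
-- up with these neighbours into an induced P5, C5 or K₂,₃.
module Submission where

open import Defs
open import Data.Nat using (ℕ; zero; suc; _+_; _≤_; z≤n; s≤s; _≤?_)
open import Data.Nat.Properties using (≰⇒>)
open import Data.Bool using (Bool; true; false)
open import Data.Bool.Properties using (¬-not) renaming (_≟_ to _≟ᵇ_)
open import Data.Fin using (Fin; zero; suc)
open import Data.Fin.Patterns using (0F; 1F; 2F; 3F)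
open import Data.Fin.Properties using (any?; all?; suc-injective) renaming (_≟_ to _≟ᶠ_)
open import Data.Fin.Subset using (Subset; _∈_; _∉_; _⊆_; _⊂_; _-_; ∁; ⁅_⁆; _∪_; ∣_∣; inside; outside)
open import Data.Fin.Subset.Properties
  using (_∈?_; x∈p∧x≢y⇒x∈p-y; p─q⊆p; x∈p⇒p-x⊂p; x∈∁p⇒x∉p; x∉p⇒x∈∁p; ∣⁅x⁆∣≡1; ∪-identityˡ; ∪-identityʳ; x∈p∪q⁻; x∈⁅y⁆⇒x≡y)
open import Data.Fin.Subset.Induction using (⊂-wellFounded; Acc; acc)
open import Data.Vec.Base using (Vec; []; _∷_; lookup; here; there)
open import Data.Vec.Relation.Unary.All using ([]; _∷_)
open import Data.Vec.Relation.Unary.AllPairs using ([]; _∷_)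
open import Data.Vec.Relation.Unary.Unique.Propositional using (Unique)
open import Data.Vec.Relation.Unary.Unique.Propositional.Properties using (lookup-injective)
open import Data.Product using (Σ; ∃; ∃₂; _×_; _,_; proj₁; proj₂)
open import Data.Sum using (_⊎_; inj₁; inj₂)
import Data.Sum as Sum
open import Data.Empty using (⊥; ⊥-elim)
open import Data.Unit using (⊤; tt)
open import Function using (_∘_)
open import Function.Definitions using (Injective)
open import Relation.Nullary using (¬_; Dec; yes; no; ¬?)
open import Relation.Nullary.Decidable using (map′; _×-dec_; _→-dec_; from-yes; decidable-stable)
open import Relation.Binary.PropositionalEquality using (_≡_; _≢_; refl; cong; trans)
import Relation.Binary.PropositionalEquality as ≡

x∉p-x : ∀ {n} (p : Subset n) {x} → x ∉ p - x
x∉p-x (_ ∷ p) {zero} ()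
x∉p-x (_ ∷ p) {suc x} (there x∈p-x) = x∉p-x p x∈p-x

∣⁅x⁆∪⁅y⁆∣≡2 : ∀ {n} {x y : Fin n} → x ≢ y → ∣ ⁅ x ⁆ ∪ ⁅ y ⁆ ∣ ≡ 2
∣⁅x⁆∪⁅y⁆∣≡2 {x = zero}  {zero}  x≢y = ⊥-elim (x≢y refl)
∣⁅x⁆∪⁅y⁆∣≡2 {x = zero}  {suc y} _   = cong suc (trans (cong ∣_∣ (∪-identityˡ ⁅ y ⁆)) (∣⁅x⁆∣≡1 y))
∣⁅x⁆∪⁅y⁆∣≡2 {x = suc x} {zero}  _   = cong suc (trans (cong ∣_∣ (∪-identityʳ ⁅ x ⁆)) (∣⁅x⁆∣≡1 x))
∣⁅x⁆∪⁅y⁆∣≡2 {x = suc x} {suc y} x≢y = ∣⁅x⁆∪⁅y⁆∣≡2 (x≢y ∘ cong suc)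

x∈⁅y⁆∪⁅z⁆⇒x≡y⊎x≡z : ∀ {n} {x y z : Fin n} → x ∈ ⁅ y ⁆ ∪ ⁅ z ⁆ → x ≡ y ⊎ x ≡ z
x∈⁅y⁆∪⁅z⁆⇒x≡y⊎x≡z {y = y} {z} x∈ = Sum.map (x∈⁅y⁆⇒x≡y y) (x∈⁅y⁆⇒x≡y z) (x∈p∪q⁻ ⁅ y ⁆ ⁅ z ⁆ x∈)

injection-into : ∀ {n} k (p : Subset n) → k ≤ ∣ p ∣ →
  Σ (Fin k → Fin n) λ f → Injective _≡_ _≡_ f × (∀ i → f i ∈ p)
injection-into zero p _ = (λ ()) , (λ { {()} }) , (λ ())
injection-into (suc k) (outside ∷ p) k<∣p∣ with injection-into (suc k) p k<∣p∣
... | f , f-inj , f∈p = suc ∘ f , f-inj ∘ suc-injective , there ∘ f∈p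
injection-into (suc k) (inside ∷ p) (s≤s k≤∣p∣) with injection-into k p k≤∣p∣
... | f , f-inj , f∈p = g , g-inj , g∈
  where
  g : Fin (suc k) → Fin _
  g zero    = zero
  g (suc i) = suc (f i)
  g-inj : Injective _≡_ _≡_ g
  g-inj {zero}  {zero}  _ = refl
  g-inj {suc i} {suc j} e = cong suc (f-inj (suc-injective e))
  g∈ : ∀ i → g i ∈ inside ∷ p
  g∈ zero    = here
  g∈ (suc i) = there (f∈p i)

module Properties {n} (G : Graph n) where

  adj-sym : ∀ {u v} → Adj G u v → Adj G v u
  adj-sym {u} {v} = trans (sym G v u)

  adj⇒≢ : ∀ {u v} → Adj G u v → u ≢ v
  adj⇒≢ {u} u∼u refl with trans (≡.sym (irrefl G u)) u∼u
  ... | ()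

  adj? : ∀ u v → Dec (Adj G u v)
  adj? u v = adj G u v ≟ᵇ true

  ¬clique⇒nonadjacent-pair : ∀ {S} → ¬ IsClique G S → ∃₂ λ u v → u ∈ S × v ∈ S × u ≢ v × ¬ Adj G u v
  ¬clique⇒nonadjacent-pair {S} ¬clique
    with any? (λ u → any? λ v → u ∈? S ×-dec v ∈? S ×-dec ¬? (u ≟ᶠ v) ×-dec ¬? (adj? u v))
  ... | yes pair = pair
  ... | no ¬pair = ⊥-elim (¬clique λ u v u∈S v∈S u≢v →
                     decidable-stable (adj? u v) λ u≁v → ¬pair (u , v , u∈S , v∈S , u≢v , u≁v))

  module _ {X : Fin n → Set} where

    reach-start : ∀ {u v} → Reach G X u v → X u
    reach-start (here x)     = x
    reach-start (step x _ _) = x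

    reach-end : ∀ {u v} → Reach G X u v → X v
    reach-end (here x)     = x
    reach-end (step _ _ r) = reach-end r

    reach-trans : ∀ {u v w} → Reach G X u v → Reach G X v w → Reach G X u w
    reach-trans (here _)     r′ = r′
    reach-trans (step x e r) r′ = step x e (reach-trans r r′)

    reach-sym : ∀ {u v} → Reach G X u v → Reach G X v u
    reach-sym (here x)     = here x
    reach-sym (step x e r) = reach-trans (reach-sym r) (step (reach-start r) (adj-sym e) (here x))

  reach-map : ∀ {X Y : Fin n → Set} → (∀ {x} → X x → Y x) → ∀ {u v} → Reach G X u v → Reach G Y u v
  reach-map f (here x)     = here (f x)
  reach-map f (step x e r) = step (f x) e (reach-map f r)

  avoid-or-exit : ∀ {X : Subset n} z {a v} → Reach G (_∈ X) a v → z ≢ v →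
    Reach G (_∈ X - z) a v ⊎ ∃ λ w → Adj G z w × Reach G (_∈ X - z) w v
  avoid-or-exit z (here a∈X) z≢v = inj₁ (here (x∈p∧x≢y⇒x∈p-y a∈X (z≢v ∘ ≡.sym)))
  avoid-or-exit z (step {a} a∈X a∼b r) z≢v with avoid-or-exit z r z≢v | a ≟ᶠ z
  ... | inj₂ exit | _        = inj₂ exit
  ... | inj₁ r′   | yes refl = inj₂ (_ , a∼b , r′)
  ... | inj₁ r′   | no a≢z   = inj₁ (step (x∈p∧x≢y⇒x∈p-y a∈X a≢z) a∼b r′)

  last-exit : ∀ {X : Subset n} {z v} → Reach G (_∈ X) z v → z ≢ v →
    ∃ λ w → Adj G z w × Reach G (_∈ X - z) w v
  last-exit {X} {z} r z≢v with avoid-or-exit z r z≢v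
  ... | inj₁ r′  = ⊥-elim (x∉p-x X (reach-start r′))
  ... | inj₂ exit = exit

  reach? : ∀ (X : Subset n) u v → Dec (Reach G (_∈ X) u v)
  reach? X = go X (⊂-wellFounded X)
    where
    go : ∀ X → Acc _⊂_ X → ∀ u v → Dec (Reach G (_∈ X) u v)
    go X (acc smaller) u v with u ∈? X | u ≟ᶠ v
    ... | no u∉X  | _        = no (u∉X ∘ reach-start)
    ... | yes u∈X | yes refl = yes (here u∈X)
    ... | yes u∈X | no u≢v
      with any? (λ w → adj? u w ×-dec go (X - u) (smaller (x∈p⇒p-x⊂p u∈X)) w v)
    ...   | yes (w , u∼w , w⇝v) = yes (step u∈X u∼w (reach-map (p─q⊆p X _) w⇝v))
    ...   | no ¬exit            = no λ u⇝v → ¬exit (last-exit u⇝v u≢v)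

  boundary-edge : ∀ {X : Fin n → Set} s {a b} → Reach G X a b → Adj G s a → ¬ Adj G s b →
    ∃₂ λ x y → Reach G X a x × Reach G X a y × Adj G x y × Adj G s x × ¬ Adj G s y
  boundary-edge s (here _) s∼a s≁a = ⊥-elim (s≁a s∼a)
  boundary-edge s (step {v = v} Xa a∼v r) s∼a s≁b with adj? s v
  ... | no s≁v  = _ , v , here Xa , step Xa a∼v (here (reach-start r)) , a∼v , s∼a , s≁v
  ... | yes s∼v with boundary-edge s r s∼v s≁b
  ...   | x , y , v⇝x , v⇝y , x∼y , s∼x , s≁y = x , y , step Xa a∼v v⇝x , step Xa a∼v v⇝y , x∼y , s∼x , s≁y

SimplePattern : ∀ {k} → (Fin k → Fin k → Bool) → Set
SimplePattern H = (∀ i j → H i j ≡ H j i) × (∀ i → H i i ≡ false)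

simplePattern? : ∀ {k} (H : Fin k → Fin k → Bool) → Dec (SimplePattern H)
simplePattern? H = (all? λ i → all? λ j → H i j ≟ᵇ H j i) ×-dec (all? λ i → H i i ≟ᵇ false)

TwinFree : ∀ {k} → (Fin k → Fin k → Bool) → Set
TwinFree H = ∀ i j → (∀ l → H i l ≡ H j l) → i ≡ j

twinFree? : ∀ {k} (H : Fin k → Fin k → Bool) → Dec (TwinFree H)
twinFree? H = all? λ i → all? λ j → all? (λ l → H i l ≟ᵇ H j l) →-dec i ≟ᶠ j

module Patterns {n} (G : Graph n) where
  open Properties G

  AdjIs : Bool → Fin n → Fin n → Set
  AdjIs true  u v = Adj G u v
  AdjIs false u v = ¬ Adj G u v

  adjIs⇒≡ : ∀ b {u v} → AdjIs b u v → adj G u v ≡ b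
  adjIs⇒≡ true  u∼v = u∼v
  adjIs⇒≡ false u≁v = ¬-not u≁v

  ≡⇒adjIs : ∀ b {u v} → adj G u v ≡ b → AdjIs b u v
  ≡⇒adjIs true  u∼v = u∼v
  ≡⇒adjIs false u≁v u∼v with trans (≡.sym u∼v) u≁v
  ... | ()

  Row : ∀ {k} → Fin n → Vec (Fin n) k → (Fin k → Bool) → Set
  Row v []                h = ⊤
  Row v (w ∷ [])          h = AdjIs (h zero) v w
  Row v (w ∷ ws@(_ ∷ _)) h = AdjIs (h zero) v w × Row v ws (h ∘ suc)

  -- The entries of H above the diagonal, row by row, as nested pairs without trailing units.
  Upper : ∀ {k} → (Fin k → Fin k → Bool) → Vec (Fin n) k → Set
  Upper H []                    = ⊤
  Upper H (_ ∷ [])              = ⊤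
  Upper H (v ∷ w ∷ [])          = Row v (w ∷ []) (H zero ∘ suc)
  Upper H (v ∷ vs@(_ ∷ _ ∷ _)) = Row v vs (H zero ∘ suc) × Upper (λ i j → H (suc i) (suc j)) vs

  upper-uncons : ∀ {k} {H : Fin (suc k) → Fin (suc k) → Bool} v vs → Upper H (v ∷ vs) →
    Row v vs (H zero ∘ suc) × Upper (λ i j → H (suc i) (suc j)) vs
  upper-uncons _ []          _     = tt , tt
  upper-uncons _ (_ ∷ [])    row   = row , tt
  upper-uncons _ (_ ∷ _ ∷ _) upper = upper

  row-lookup : ∀ {k v} (ws : Vec (Fin n) k) h → Row v ws h → ∀ j → adj G v (lookup ws j) ≡ h j
  row-lookup (_ ∷ [])     h v-w       zero    = adjIs⇒≡ (h zero) v-w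
  row-lookup (_ ∷ _ ∷ _)  h (v-w , _) zero    = adjIs⇒≡ (h zero) v-w
  row-lookup (_ ∷ ws@(_ ∷ _)) h (_ , row) (suc j) = row-lookup ws (h ∘ suc) row j

  upper⇒table : ∀ {k} {H : Fin k → Fin k → Bool} → SimplePattern H → ∀ vs → Upper H vs →
    ∀ i j → adj G (lookup vs i) (lookup vs j) ≡ H i j
  upper⇒table (_ , H-irrefl) (v ∷ _) _ zero zero = trans (irrefl G v) (≡.sym (H-irrefl zero))
  upper⇒table {H = H} _ (v ∷ vs) upper zero (suc j) =
    row-lookup vs (H zero ∘ suc) (proj₁ (upper-uncons v vs upper)) j
  upper⇒table {H = H} (H-sym , _) (v ∷ vs) upper (suc i) zero = begin
    adj G (lookup vs i) v  ≡⟨ sym G (lookup vs i) v ⟩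
    adj G v (lookup vs i)  ≡⟨ row-lookup vs (H zero ∘ suc) (proj₁ (upper-uncons v vs upper)) i ⟩
    H zero (suc i)         ≡⟨ H-sym zero (suc i) ⟩
    H (suc i) zero         ∎
    where open ≡.≡-Reasoning
  upper⇒table (H-sym , H-irrefl) (v ∷ vs) upper (suc i) (suc j) =
    upper⇒table ((λ i j → H-sym (suc i) (suc j)) , H-irrefl ∘ suc) vs (proj₂ (upper-uncons v vs upper)) i j

  table⇒twins : ∀ {k} {H : Fin k → Fin k → Bool} {f : Fin k → Fin n} →
    (∀ i j → adj G (f i) (f j) ≡ H i j) → ∀ {i j} → f i ≡ f j → ∀ l → H i l ≡ H j l
  table⇒twins {f = f} table {i} {j} fi≡fj l =
    trans (≡.sym (table i l)) (trans (cong (λ x → adj G x (f l)) fi≡fj) (table j l))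

  induced-twinFree : ∀ {k} {H : Fin k → Fin k → Bool} → SimplePattern H → TwinFree H →
    ∀ vs → Upper H vs → ContainsInduced k H G
  induced-twinFree simple twinFree vs upper =
    lookup vs , (λ e → twinFree _ _ (table⇒twins table e)) , table
    where table = upper⇒table simple vs upper

  induced-unique : ∀ {k} {H : Fin k → Fin k → Bool} → SimplePattern H →
    ∀ vs → Unique vs → Upper H vs → ContainsInduced k H G
  induced-unique simple vs unique upper =
    lookup vs , lookup-injective unique _ _ , upper⇒table simple vs upper

P5-simple : SimplePattern (pathAdj 5)
P5-simple = from-yes (simplePattern? (pathAdj 5))

C5-simple : SimplePattern (cycleAdj 5)
C5-simple = from-yes (simplePattern? (cycleAdj 5))

K23-simple : SimplePattern k23Adj
K23-simple = from-yes (simplePattern? k23Adj)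

P5-twinFree : TwinFree (pathAdj 5)
P5-twinFree = from-yes (twinFree? (pathAdj 5))

C5-twinFree : TwinFree (cycleAdj 5)
C5-twinFree = from-yes (twinFree? (cycleAdj 5))

module Components {n} (G : Graph n) (S : Subset n) where
  open Properties G

  infix 4 _≈_ _≈?_

  _≈_ : Fin n → Fin n → Set
  a ≈ b = ConnMinus G S a b

  _≈?_ : ∀ a b → Dec (a ≈ b)
  a ≈? b = map′ (reach-map x∈∁p⇒x∉p) (reach-map x∉p⇒x∈∁p) (reach? (∁ S) a b)

  separated⇒≢ : ∀ {r q x y} → r ≈ x → q ≈ y → ¬ r ≈ q → x ≢ y
  separated⇒≢ r≈x q≈y r≉q refl = r≉q (reach-trans r≈x (reach-sym q≈y))

  separated⇒≁ : ∀ {r q x y} → r ≈ x → q ≈ y → ¬ r ≈ q → ¬ Adj G x y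
  separated⇒≁ r≈x q≈y r≉q x∼y = r≉q (reach-trans r≈x (step (reach-end r≈x) x∼y (reach-sym q≈y)))

  leaving-component : ∀ {X : Fin n → Set} {a b} → Reach G X a b → a ∉ S → ¬ a ≈ b →
    ∃₂ λ c t → a ≈ c × Adj G c t × t ∈ S × X t
  leaving-component (here _) a∉S a≉a = ⊥-elim (a≉a (here a∉S))
  leaving-component (step {v = v} _ a∼v r) a∉S a≉b with v ∈? S
  ... | yes v∈S = _ , v , here a∉S , a∼v , v∈S , reach-start r
  ... | no v∉S with leaving-component r v∉S (a≉b ∘ step a∉S a∼v)
  ...   | c , t , v≈c , c∼t , t∈S , Xt = c , t , step a∉S a∼v v≈c , c∼t , t∈S , Xt

module MinimalCut {n} (G : Graph n) (S : Subset n) {u₀ v₀ : Fin n}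
  (u₀∉S : u₀ ∉ S) (v₀∉S : v₀ ∉ S) (u₀≉v₀ : ¬ ConnMinus G S u₀ v₀)
  (minimal : ∀ T → T ⊂ S → ¬ CutSet G T) where
  open Properties G
  open Components G S

  other-component : ∀ a → ∃ λ b → b ∉ S × ¬ a ≈ b
  other-component a with a ≈? u₀
  ... | yes a≈u₀ = v₀ , v₀∉S , λ a≈v₀ → u₀≉v₀ (reach-trans (reach-sym a≈u₀) a≈v₀)
  ... | no  a≉u₀ = u₀ , u₀∉S , a≉u₀

  -- S - s is not a cut set, so a walk joins a to another component of G - S avoiding S - s;
  -- it can only leave the component of a through s.
  neighbour-in-component : ∀ {s} → s ∈ S → ∀ {a} → a ∉ S → ∃ λ c → a ≈ c × Adj G s c
  neighbour-in-component {s} s∈S {a} a∉S with other-component a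
  ... | b , b∉S , a≉b with Components._≈?_ G (S - s) a b
  ...   | no a≉b-s = ⊥-elim (minimal (S - s) (x∈p⇒p-x⊂p s∈S)
                               (a , b , a∉S ∘ p─q⊆p S _ , b∉S ∘ p─q⊆p S _ , a≉b-s))
  ...   | yes a⇝b with leaving-component a⇝b a∉S a≉b
  ...     | c , t , a≈c , c∼t , t∈S , t∉S-s with t ≟ᶠ s
  ...       | yes refl = c , a≈c , adj-sym c∼t
  ...       | no  t≢s  = ⊥-elim (t∉S-s (x∈p∧x≢y⇒x∈p-y t∈S t≢s))

  module Free (P5-free : ¬ ContainsInduced 5 (pathAdj 5) G) (C5-free : ¬ ContainsInduced 5 (cycleAdj 5) G)
    (K23-free : ¬ ContainsInduced 5 k23Adj G) where
    open Patterns G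

    no-P5 : ∀ {a b c d e} → ¬ Upper (pathAdj 5) (a ∷ b ∷ c ∷ d ∷ e ∷ [])
    no-P5 {a} {b} {c} {d} {e} upper =
      P5-free (induced-twinFree P5-simple P5-twinFree (a ∷ b ∷ c ∷ d ∷ e ∷ []) upper)

    no-C5 : ∀ {a b c d e} → ¬ Upper (cycleAdj 5) (a ∷ b ∷ c ∷ d ∷ e ∷ [])
    no-C5 {a} {b} {c} {d} {e} upper =
      C5-free (induced-twinFree C5-simple C5-twinFree (a ∷ b ∷ c ∷ d ∷ e ∷ []) upper)

    no-K23 : ∀ {a b c d e} → a ≢ b → c ≢ d → c ≢ e → d ≢ e → ¬ Upper k23Adj (a ∷ b ∷ c ∷ d ∷ e ∷ [])
    no-K23 {a} {b} {c} {d} {e} a≢b c≢d c≢e d≢e upper@((_ , a∼c , a∼d , a∼e) , (b∼c , b∼d , b∼e) , _) =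
      K23-free (induced-unique K23-simple (a ∷ b ∷ c ∷ d ∷ e ∷ []) distinct upper)
      where
      distinct : Unique _
      distinct = (a≢b ∷ adj⇒≢ a∼c ∷ adj⇒≢ a∼d ∷ adj⇒≢ a∼e ∷ [])
               ∷ (adj⇒≢ b∼c ∷ adj⇒≢ b∼d ∷ adj⇒≢ b∼e ∷ [])
               ∷ (c≢d ∷ c≢e ∷ []) ∷ (d≢e ∷ []) ∷ [] ∷ []

    -- Boundary edges x y in the component of r and x′ y′ in that of q give the induced P5 y x s x′ y′.
    complete-to-other : ∀ {s} → s ∈ S → ∀ {r q} → r ∉ S → q ∉ S → ¬ r ≈ q →
      ∀ {b} → r ≈ b → ¬ Adj G s b → ∀ {c} → q ≈ c → Adj G s c
    complete-to-other {s} s∈S r∉S q∉S r≉q r≈b s≁b {c} q≈c with adj? s c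
    ... | yes s∼c = s∼c
    ... | no  s≁c with neighbour-in-component s∈S r∉S | neighbour-in-component s∈S q∉S
    ...   | a , r≈a , s∼a | a′ , q≈a′ , s∼a′
      with boundary-edge s (reach-trans (reach-sym r≈a) r≈b) s∼a s≁b
         | boundary-edge s (reach-trans (reach-sym q≈a′) q≈c) s∼a′ s≁c
    ... | x , y , a≈x , a≈y , x∼y , s∼x , s≁y | x′ , y′ , a′≈x′ , a′≈y′ , x′∼y′ , s∼x′ , s≁y′ =
      ⊥-elim (no-P5 ( (adj-sym x∼y , s≁y ∘ adj-sym , apart a≈y a′≈x′ , apart a≈y a′≈y′)
                    , (adj-sym s∼x , apart a≈x a′≈x′ , apart a≈x a′≈y′)
                    , (s∼x′ , s≁y′) , x′∼y′))
      where
      apart : ∀ {z z′} → a ≈ z → a′ ≈ z′ → ¬ Adj G z z′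
      apart a≈z a′≈z′ = separated⇒≁ (reach-trans r≈a a≈z) (reach-trans q≈a′ a′≈z′) r≉q

    no-private-boundary-edge : ∀ {s₁ s₂ q x y} → ¬ Adj G s₁ s₂ → Adj G s₁ q → Adj G s₂ q →
      Adj G x y → ¬ Adj G x q → ¬ Adj G y q → Adj G s₂ x → ¬ Adj G s₂ y → ¬ Adj G s₁ x → ⊥
    no-private-boundary-edge {s₁} {y = y} s₁≁s₂ s₁∼q s₂∼q x∼y x≁q y≁q s₂∼x s₂≁y s₁≁x with adj? s₁ y
    ... | yes s₁∼y = no-C5 ( (s₁∼y , s₁≁x , s₁≁s₂ , s₁∼q)
                           , (adj-sym x∼y , s₂≁y ∘ adj-sym , y≁q)
                           , (adj-sym s₂∼x , x≁q) , s₂∼q)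
    ... | no  s₁≁y = no-P5 ( (adj-sym x∼y , s₂≁y ∘ adj-sym , y≁q , s₁≁y ∘ adj-sym)
                           , (adj-sym s₂∼x , x≁q , s₁≁x ∘ adj-sym)
                           , (s₂∼q , s₁≁s₂ ∘ adj-sym) , adj-sym s₁∼q)

    -- s₁ and s₂ each miss a vertex of the component of r, so both are complete to that of q.
    common-neighbour : ∀ {s₁ s₂} → s₁ ∈ S → s₂ ∈ S → ¬ Adj G s₁ s₂ →
      ∀ {r q} → r ∉ S → q ∉ S → ¬ r ≈ q → ∃ λ c → r ≈ c × Adj G s₁ c × Adj G s₂ c
    common-neighbour {s₁} {s₂} s₁∈S s₂∈S s₁≁s₂ {r} {q} r∉S q∉S r≉q
      with any? (λ c → r ≈? c ×-dec adj? s₁ c ×-dec adj? s₂ c)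
    ... | yes common = common
    ... | no ¬common
      with neighbour-in-component s₁∈S r∉S | neighbour-in-component s₂∈S r∉S
    ...   | a₁ , r≈a₁ , s₁∼a₁ | a₂ , r≈a₂ , s₂∼a₂
      with boundary-edge s₂ (reach-trans (reach-sym r≈a₂) r≈a₁) s₂∼a₂
             (λ s₂∼a₁ → ¬common (a₁ , r≈a₁ , s₁∼a₁ , s₂∼a₁))
    ...     | x , y , a₂≈x , a₂≈y , x∼y , s₂∼x , s₂≁y =
      ⊥-elim (no-private-boundary-edge s₁≁s₂
                (complete s₁∈S r≈a₂ (λ s₁∼a₂ → ¬common (a₂ , r≈a₂ , s₁∼a₂ , s₂∼a₂)))
                (complete s₂∈S r≈a₁ (λ s₂∼a₁ → ¬common (a₁ , r≈a₁ , s₁∼a₁ , s₂∼a₁)))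
                x∼y (outside-q r≈x) (outside-q (reach-trans r≈a₂ a₂≈y)) s₂∼x s₂≁y
                (λ s₁∼x → ¬common (x , r≈x , s₁∼x , s₂∼x)))
      where
      r≈x = reach-trans r≈a₂ a₂≈x
      outside-q : ∀ {z} → r ≈ z → ¬ Adj G z q
      outside-q r≈z = separated⇒≁ r≈z (here q∉S) r≉q
      complete : ∀ {s b} → s ∈ S → r ≈ b → ¬ Adj G s b → Adj G s q
      complete s∈S r≈b s≁b = complete-to-other s∈S r∉S q∉S r≉q r≈b s≁b (here q∉S)

    -- A third component would give common neighbours of s₁ and s₂ in three components: an induced K₂,₃.
    exactly-two-components : ∀ {s₁ s₂} → s₁ ∈ S → s₂ ∈ S → s₁ ≢ s₂ → ¬ Adj G s₁ s₂ →
      ExactlyTwoComponents G S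
    exactly-two-components s₁∈S s₂∈S s₁≢s₂ s₁≁s₂ = u₀ , v₀ , u₀∉S , v₀∉S , u₀≉v₀ , two
      where
      two : ∀ c → c ∉ S → u₀ ≈ c ⊎ v₀ ≈ c
      two c c∉S with u₀ ≈? c | v₀ ≈? c
      ... | yes u₀≈c | _        = inj₁ u₀≈c
      ... | no  _    | yes v₀≈c = inj₂ v₀≈c
      ... | no  u₀≉c | no  v₀≉c
        with common-neighbour s₁∈S s₂∈S s₁≁s₂ u₀∉S v₀∉S u₀≉v₀
           | common-neighbour s₁∈S s₂∈S s₁≁s₂ v₀∉S u₀∉S (u₀≉v₀ ∘ reach-sym)
           | common-neighbour s₁∈S s₂∈S s₁≁s₂ c∉S u₀∉S (u₀≉c ∘ reach-sym)
      ... | x , u₀≈x , s₁∼x , s₂∼x | y , v₀≈y , s₁∼y , s₂∼y | z , c≈z , s₁∼z , s₂∼z =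
        ⊥-elim (no-K23 s₁≢s₂ (separated⇒≢ u₀≈x v₀≈y u₀≉v₀) (separated⇒≢ u₀≈x c≈z u₀≉c)
                  (separated⇒≢ v₀≈y c≈z v₀≉c)
                  ( (s₁≁s₂ , s₁∼x , s₁∼y , s₁∼z) , (s₂∼x , s₂∼y , s₂∼z)
                  , (separated⇒≁ u₀≈x v₀≈y u₀≉v₀ , separated⇒≁ u₀≈x c≈z u₀≉c)
                  , separated⇒≁ v₀≈y c≈z v₀≉c))

    -- Through a neighbour d of s in another component, s x y w extends to an induced C5 or P5.
    no-induced-P4-into-component : ∀ {s x y w} → s ∈ S → x ∉ S → x ≈ y →
      ¬ Upper (pathAdj 4) (s ∷ x ∷ y ∷ w ∷ [])
    no-induced-P4-into-component {w = w} s∈S x∉S x≈y ((s∼x , s≁y , s≁w) , (x∼y , x≁w) , y∼w)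
      with other-component _
    ... | q , q∉S , x≉q with neighbour-in-component s∈S q∉S
    ...   | d , q≈d , s∼d = close (adj? d w)
      where
      d≁x = separated⇒≁ q≈d (here x∉S) (x≉q ∘ reach-sym)
      d≁y = separated⇒≁ q≈d x≈y (x≉q ∘ reach-sym)
      close : Dec (Adj G d w) → ⊥
      close (yes d∼w) = no-C5 ((adj-sym s∼d , d≁x , d≁y , d∼w) , (s∼x , s≁y , s≁w) , (x∼y , x≁w) , y∼w)
      close (no  d≁w) = no-P5 ((adj-sym s∼d , d≁x , d≁y , d≁w) , (s∼x , s≁y , s≁w) , (x∼y , x≁w) , y∼w)

    induced-paths-length-2 : InducedPathsLength2 G S
    induced-paths-length-2 _ _ _ _ s₁≢s₂ _ 0 _ _ refl refl _ _ = ⊥-elim (s₁≢s₂ refl)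
    induced-paths-length-2 _ _ _ _ _ s₁≁s₂ 1 _ (_ , table) refl refl _ _ = ⊥-elim (s₁≁s₂ (table 0F 1F))
    induced-paths-length-2 _ _ _ _ _ _ 2 _ _ _ _ _ _ = refl
    induced-paths-length-2 _ _ s₁∈S _ _ _ (suc (suc (suc m))) p (_ , table) refl _ internal∉S connected =
      ⊥-elim (no-induced-P4-into-component s₁∈S (internal∉S 1F one-internal)
                (connected 1F 2F one-internal two-internal)
                ((edge 0F 1F , edge 0F 2F , edge 0F 3F) , (edge 1F 2F , edge 1F 3F) , edge 2F 3F))
      where
      edge : ∀ i j → AdjIs (pathAdj (4 + m) i j) (p i) (p j)
      edge i j = ≡⇒adjIs _ (table i j)
      one-internal : IsInternal {3 + m} 1F
      one-internal = s≤s z≤n , s≤s (s≤s z≤n)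
      two-internal : IsInternal {3 + m} 2F
      two-internal = s≤s z≤n , s≤s (s≤s (s≤s z≤n))

    complete-to-some-component : CompleteToSomeComponent G S
    complete-to-some-component s s∈S with any? (λ b → u₀ ≈? b ×-dec ¬? (adj? s b))
    ... | yes (b , u₀≈b , s≁b) =
      v₀ , v₀∉S , λ _ v₀≈c → complete-to-other s∈S u₀∉S v₀∉S u₀≉v₀ u₀≈b s≁b v₀≈c
    ... | no ¬missed =
      u₀ , u₀∉S , λ c u₀≈c → decidable-stable (adj? s c) (λ s≁c → ¬missed (c , u₀≈c , s≁c))

    module _ {s₁ s₂ s₃} (s₁∈S : s₁ ∈ S) (s₂∈S : s₂ ∈ S) (s₃∈S : s₃ ∈ S)
      (s₁≢s₂ : s₁ ≢ s₂) (s₁≢s₃ : s₁ ≢ s₃) (s₂≢s₃ : s₂ ≢ s₃)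
      (s₁≁s₂ : ¬ Adj G s₁ s₂) (s₁≁s₃ : ¬ Adj G s₁ s₃) (s₂≁s₃ : ¬ Adj G s₂ s₃) where

      no-separate-pair-neighbours : ∀ {r q y₁₂ y₁₃ x} → ¬ r ≈ q → r ≈ y₁₂ → r ≈ y₁₃ → q ≈ x →
        Adj G s₁ y₁₂ → Adj G s₂ y₁₂ → ¬ Adj G s₃ y₁₂ →
        Adj G s₁ y₁₃ → Adj G s₃ y₁₃ → ¬ Adj G s₂ y₁₃ →
        Adj G s₁ x → Adj G s₂ x → ⊥
      no-separate-pair-neighbours {y₁₂ = y₁₂} {y₁₃} {x} r≉q r≈y₁₂ r≈y₁₃ q≈x
        s₁∼y₁₂ s₂∼y₁₂ s₃≁y₁₂ s₁∼y₁₃ s₃∼y₁₃ s₂≁y₁₃ s₁∼x s₂∼x with adj? y₁₂ y₁₃ | adj? s₃ x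
      ... | no y₁₂≁y₁₃ | _ =
        no-P5 ( (s₂∼y₁₂ , s₁≁s₂ ∘ adj-sym , s₂≁y₁₃ , s₂≁s₃)
              , (adj-sym s₁∼y₁₂ , y₁₂≁y₁₃ , s₃≁y₁₂ ∘ adj-sym) , (s₁∼y₁₃ , s₁≁s₃) , adj-sym s₃∼y₁₃)
      ... | yes y₁₂∼y₁₃ | yes s₃∼x =
        no-C5 ( (s₂∼y₁₂ , s₂≁y₁₃ , s₂≁s₃ , s₂∼x)
              , (y₁₂∼y₁₃ , s₃≁y₁₂ ∘ adj-sym , separated⇒≁ r≈y₁₂ q≈x r≉q)
              , (adj-sym s₃∼y₁₃ , separated⇒≁ r≈y₁₃ q≈x r≉q) , s₃∼x)
      ... | yes _ | no s₃≁x =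
        no-P5 ( (s₃∼y₁₃ , s₁≁s₃ ∘ adj-sym , s₃≁x , s₂≁s₃ ∘ adj-sym)
              , (adj-sym s₁∼y₁₃ , separated⇒≁ r≈y₁₃ q≈x r≉q , s₂≁y₁₃ ∘ adj-sym)
              , (s₁∼x , s₁≁s₂) , adj-sym s₂∼x)

      no-triple-neighbour : ∀ {r q t x₁₂ x₁₃} → ¬ r ≈ q → q ≈ t → r ≈ x₁₂ → r ≈ x₁₃ →
        Adj G s₁ t → Adj G s₂ t → Adj G s₃ t →
        Adj G s₁ x₁₂ → Adj G s₂ x₁₂ → Adj G s₁ x₁₃ → Adj G s₃ x₁₃ → ⊥
      no-triple-neighbour {r} {x₁₂ = x₁₂} {x₁₃} r≉q q≈t r≈x₁₂ r≈x₁₃ s₁∼t s₂∼t s₃∼t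
        s₁∼x₁₂ s₂∼x₁₂ s₁∼x₁₃ s₃∼x₁₃ = close (adj? s₃ x₁₂) (adj? s₂ x₁₃)
        where
        no-K23-over : ∀ {x} → r ≈ x → Adj G s₁ x → Adj G s₂ x → Adj G s₃ x → ⊥
        no-K23-over r≈x s₁∼x s₂∼x s₃∼x =
          no-K23 (separated⇒≢ r≈x q≈t r≉q) s₁≢s₂ s₁≢s₃ s₂≢s₃
            ( (separated⇒≁ r≈x q≈t r≉q , adj-sym s₁∼x , adj-sym s₂∼x , adj-sym s₃∼x)
            , (adj-sym s₁∼t , adj-sym s₂∼t , adj-sym s₃∼t) , (s₁≁s₂ , s₁≁s₃) , s₂≁s₃)
        close : Dec (Adj G s₃ x₁₂) → Dec (Adj G s₂ x₁₃) → ⊥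
        close (yes s₃∼x₁₂) _            = no-K23-over r≈x₁₂ s₁∼x₁₂ s₂∼x₁₂ s₃∼x₁₂
        close (no  _)      (yes s₂∼x₁₃) = no-K23-over r≈x₁₃ s₁∼x₁₃ s₂∼x₁₃ s₃∼x₁₃
        close (no s₃≁x₁₂)  (no s₂≁x₁₃)  =
          no-separate-pair-neighbours r≉q r≈x₁₂ r≈x₁₃ q≈t
            s₁∼x₁₂ s₂∼x₁₂ s₃≁x₁₂ s₁∼x₁₃ s₃∼x₁₃ s₂≁x₁₃ s₁∼t s₂∼t

      no-independent-triple : ⊥
      no-independent-triple
        with common-neighbour s₁∈S s₂∈S s₁≁s₂ u₀∉S v₀∉S u₀≉v₀
           | common-neighbour s₁∈S s₃∈S s₁≁s₃ u₀∉S v₀∉S u₀≉v₀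
           | common-neighbour s₁∈S s₂∈S s₁≁s₂ v₀∉S u₀∉S (u₀≉v₀ ∘ reach-sym)
           | common-neighbour s₁∈S s₃∈S s₁≁s₃ v₀∉S u₀∉S (u₀≉v₀ ∘ reach-sym)
      ... | x₁₂ , u₀≈x₁₂ , s₁∼x₁₂ , s₂∼x₁₂ | x₁₃ , u₀≈x₁₃ , s₁∼x₁₃ , s₃∼x₁₃
          | y₁₂ , v₀≈y₁₂ , s₁∼y₁₂ , s₂∼y₁₂ | y₁₃ , v₀≈y₁₃ , s₁∼y₁₃ , s₃∼y₁₃ =
        close (adj? s₃ y₁₂) (adj? s₂ y₁₃)
        where
        close : Dec (Adj G s₃ y₁₂) → Dec (Adj G s₂ y₁₃) → ⊥
        close (yes s₃∼y₁₂) _ =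
          no-triple-neighbour u₀≉v₀ v₀≈y₁₂ u₀≈x₁₂ u₀≈x₁₃ s₁∼y₁₂ s₂∼y₁₂ s₃∼y₁₂ s₁∼x₁₂ s₂∼x₁₂ s₁∼x₁₃ s₃∼x₁₃
        close (no _) (yes s₂∼y₁₃) =
          no-triple-neighbour u₀≉v₀ v₀≈y₁₃ u₀≈x₁₂ u₀≈x₁₃ s₁∼y₁₃ s₂∼y₁₃ s₃∼y₁₃ s₁∼x₁₂ s₂∼x₁₂ s₁∼x₁₃ s₃∼x₁₃
        close (no s₃≁y₁₂) (no s₂≁y₁₃) =
          no-separate-pair-neighbours (u₀≉v₀ ∘ reach-sym) v₀≈y₁₂ v₀≈y₁₃ u₀≈x₁₂
            s₁∼y₁₂ s₂∼y₁₂ s₃≁y₁₂ s₁∼y₁₃ s₃∼y₁₃ s₂≁y₁₃ s₁∼x₁₂ s₂∼x₁₂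

    independence-number-2 : ∀ {s₁ s₂} → s₁ ∈ S → s₂ ∈ S → s₁ ≢ s₂ → ¬ Adj G s₁ s₂ →
      IndependenceNumberOfInduced G S 2
    independence-number-2 {s₁} {s₂} s₁∈S s₂∈S s₁≢s₂ s₁≁s₂ =
      (⁅ s₁ ⁆ ∪ ⁅ s₂ ⁆ , pair⊆S , pair-independent , ∣⁅x⁆∪⁅y⁆∣≡2 s₁≢s₂) , at-most-two
      where
      pair⊆S : ⁅ s₁ ⁆ ∪ ⁅ s₂ ⁆ ⊆ S
      pair⊆S x∈ with x∈⁅y⁆∪⁅z⁆⇒x≡y⊎x≡z x∈
      ... | inj₁ refl = s₁∈S
      ... | inj₂ refl = s₂∈S
      pair-independent : IsIndependent G (⁅ s₁ ⁆ ∪ ⁅ s₂ ⁆)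
      pair-independent u v u∈ v∈ u∼v with x∈⁅y⁆∪⁅z⁆⇒x≡y⊎x≡z u∈ | x∈⁅y⁆∪⁅z⁆⇒x≡y⊎x≡z v∈
      ... | inj₁ refl | inj₁ refl = adj⇒≢ u∼v refl
      ... | inj₁ refl | inj₂ refl = s₁≁s₂ u∼v
      ... | inj₂ refl | inj₁ refl = s₁≁s₂ (adj-sym u∼v)
      ... | inj₂ refl | inj₂ refl = adj⇒≢ u∼v refl
      at-most-two : ∀ T → T ⊆ S → IsIndependent G T → ∣ T ∣ ≤ 2
      at-most-two T T⊆S independent with ∣ T ∣ ≤? 2
      ... | yes ∣T∣≤2 = ∣T∣≤2
      ... | no  ∣T∣≰2 with injection-into 3 T (≰⇒> ∣T∣≰2)
      ...   | f , f-inj , f∈T =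
        ⊥-elim (no-independent-triple (T⊆S (f∈T 0F)) (T⊆S (f∈T 1F)) (T⊆S (f∈T 2F))
                  ((λ ()) ∘ f-inj) ((λ ()) ∘ f-inj) ((λ ()) ∘ f-inj)
                  (independent _ _ (f∈T 0F) (f∈T 1F)) (independent _ _ (f∈T 0F) (f∈T 2F))
                  (independent _ _ (f∈T 1F) (f∈T 2F)))

lemma3p1 : ∀ {n : ℕ} (G : Graph n) → Connected G → P5C5K23Free G → ¬ HasCliqueCutSet G →
    ∀ (S : Subset n) → MinimalCutSet G S →
    (ExactlyTwoComponents G S × InducedPathsLength2 G S)
    × CompleteToSomeComponent G S
    × IndependenceNumberOfInduced G S 2
lemma3p1 G _ (P5-free , C5-free , K23-free) ¬clique-cut S (cut@(_ , _ , u₀∉S , v₀∉S , u₀≉v₀) , minimal)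
  with Properties.¬clique⇒nonadjacent-pair G (λ clique → ¬clique-cut (S , cut , clique))
... | s₁ , s₂ , s₁∈S , s₂∈S , s₁≢s₂ , s₁≁s₂ =
  (exactly-two-components s₁∈S s₂∈S s₁≢s₂ s₁≁s₂ , induced-paths-length-2) ,
  complete-to-some-component , independence-number-2 s₁∈S s₂∈S s₁≢s₂ s₁≁s₂
  where open MinimalCut.Free G S u₀∉S v₀∉S u₀≉v₀ minimal P5-free C5-free K23-free
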